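{- Let $G=(V,E)$ be a directed acyclic graph with no active cycle and let $v_1,v_2\in V$ with $v_1\to v_2\in E$. Suppose $v_1\leftarrow x_1\sim\cdots\sim x_n\sim v_2$ is a trail activated by the empty set whose first arc is $x_1\to v_1$, with $n\ge1$, and which has the minimum number of nodes among all trails between $v_1$ and $v_2$ activated by the empty set whose first arc points into $v_1$. Then, with the convention $x_{n+1}:=v_2$, we have $x_i\to x_{i+1}\in E$ for all $i\in\{1,\dots,n\}$ and $v_1\to x_i\in E$ for all $i\in\{2,\dots,n\}$. Furthermore, the same conclusion holds if the trail $v_1\leftarrow x_1\sim\cdots\sim x_n\to v_2$, $n\ge1$, has instead the minimum number of nodes among all trails between $v_1$ and $v_2$ activated by the empty set whose first arc points into $v_1$ and whose last arc points into $v_2$.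
   Context: Graphs are finite, simple, without loops. A trail is a sequence of pairwise distinct nodes with consecutive nodes adjacent (arc in either direction), written $v_1\sim\cdots\sim v_n$, with $\to$/$\leftarrow$ indicating a known direction. An interior node $v_j$ is a converging connection if $v_{j-1}\to v_j\leftarrow v_{j+1}$, otherwise serial or diverging. A trail is activated by the empty set iff it has no converging connection. $G$ contains an active cycle if there exist a node $v$, distinct parents $w,z$ of $v$, and a trail $w\sim y_1\sim\cdots\sim y_m\sim z$ with $m\ge1$ all of whose interior nodes are serial or diverging connections, such that the cycle $v,w,y_1,\dots,y_m,z$ has no arc of $G$ between two of its nodes that are not consecutive in this cyclic order. -}

module Defs where

open import Data.Nat using (ℕ; zero; suc; _<_; _≤_)
open import Data.Fin using (Fin; toℕ)
open import Data.Bool using (Bool; T)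
open import Data.List using (List; []; _∷_; _∷ʳ_; _++_; length; lookup; reverse)
open import Data.List.Relation.Unary.Linked using (Linked)
open import Data.List.Relation.Unary.Unique.Propositional using (Unique)
open import Data.Maybe using (Maybe; just)
open import Data.Product using (_×_; Σ; ∃; ∃-syntax)
open import Data.Sum using (_⊎_)
open import Data.Unit using (⊤)
open import Data.Empty using (⊥)
open import Relation.Nullary using (¬_)
open import Relation.Binary.PropositionalEquality using (_≡_; _≢_)

Digraph : ℕ → Set
Digraph N = Fin N → Fin N → Bool

module _ {N : ℕ} (E : Digraph N) where

  Arc : Fin N → Fin N → Set
  Arc u v = T (E u v)

  Adj : Fin N → Fin N → Set
  Adj u v = Arc u v ⊎ Arc v u

  -- directed acyclic: no directed closed walk u → l₁ → … → lₖ → u (k ≥ 0);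
  -- in particular no loops and no pair of opposite arcs
  Acyclic : Set
  Acyclic = (u : Fin N) (l : List (Fin N)) → ¬ Linked Arc (u ∷ l ∷ʳ u)

  IsTrail : List (Fin N) → Set
  IsTrail l = Unique l × Linked Adj l

  NoConverging : List (Fin N) → Set
  NoConverging (a ∷ b ∷ c ∷ rest) = ¬ (Arc a b × Arc c b) × NoConverging (b ∷ c ∷ rest)
  NoConverging _ = ⊤

  -- trail activated by the empty set
  ActiveTrail : List (Fin N) → Set
  ActiveTrail l = IsTrail l × NoConverging l

  StartsAt : Fin N → List (Fin N) → Set
  StartsAt u [] = ⊥
  StartsAt u (a ∷ _) = a ≡ u

  Between : Fin N → Fin N → List (Fin N) → Set
  Between u v l = StartsAt u l × StartsAt v (reverse l)

  FirstArcInto : Fin N → List (Fin N) → Set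
  FirstArcInto u (a ∷ b ∷ _) = (a ≡ u) × Arc b a
  FirstArcInto u _ = ⊥

  LastArcInto : Fin N → List (Fin N) → Set
  LastArcInto v l = FirstArcInto v (reverse l)

  -- no arc between nodes of c that are not consecutive in cyclic order
  Chordless : List (Fin N) → Set
  Chordless c = (i j : Fin (length c)) → toℕ i < toℕ j →
    suc (toℕ i) ≢ toℕ j → ¬ (toℕ i ≡ 0 × suc (toℕ j) ≡ length c) →
    ¬ Adj (lookup c i) (lookup c j)

  -- active cycle: node v, distinct parents w, z, trail w ∼ y₁ ∼ … ∼ yₘ ∼ z
  -- (m ≥ 1) with no converging connection, such that the cycle
  -- v, w, y₁, …, yₘ, z (pairwise distinct nodes) is chordless
  ActiveCycle : Set
  ActiveCycle = ∃[ v ] ∃[ w ] ∃[ z ] ∃[ y ] ∃[ ys ]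
    (w ≢ z × Arc w v × Arc z v ×
     ActiveTrail (w ∷ (y ∷ ys) ∷ʳ z) ×
     Unique (v ∷ w ∷ (y ∷ ys) ∷ʳ z) ×
     Chordless (v ∷ w ∷ (y ∷ ys) ∷ʳ z))

{-# OPTIONS --safe #-}
-- Write the trail as p 0 = v₁, p 1 = x₁, …, p (n+1) = v₂.  Since it has no converging
-- connection and G is acyclic, once an arc of the trail points forward so do all later ones,
-- and once one points backward so do all earlier ones; together with v₁ → v₂ this forces
-- xₙ → v₂, so both parts are about a shortest trail whose end arcs point into its ends.
-- A chord p i ∼ p j with j ≥ i + 2 lets us bypass p (i+1), …, p (j-1) and get a shorter such
-- trail.  For i ≥ 1 each possible obstruction (a converging connection at either junction,
-- or a last arc out of v₂) closes a directed cycle, so there is no such chord; for i = 0 the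
-- bypass shows that the chord is v₁ → p j, and then p (j-1) → p j by acyclicity.
-- Finally p t → p (t+1) ← v₁ holds for t = n and descends to every t ≥ 1: if p b is the last
-- neighbour of v₁ among p 1, …, p (t+1) and b ≤ t, then the common child p (t+2) of v₁ and
-- p (t+1), together with the trail v₁, p b, …, p (t+1), forms a chordless active cycle.
module Submission where

open import Defs
open import Data.Nat using (ℕ; suc; _≤_)
open import Data.Fin using (Fin; toℕ; inject₁)
import Data.Fin as F
open import Data.Vec using (Vec; head; last; lookup; toList; _∷ʳ_)
open import Data.List using (List; _∷_; length)
open import Data.Product using (_×_)
open import Relation.Nullary using (¬_)

open import Data.Nat using (zero; _+_; _∸_; _<_; z≤n; s≤s; z<s; s<s)
open import Data.Nat using (_≤′_; ≤′-refl; ≤′-step; _≤‴_; ≤‴-refl; ≤‴-step)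
open import Data.Nat.Properties
open import Data.Fin.Properties using (toℕ<n; toℕ-inject₁)
open import Data.Vec using ([]; _∷_)
open import Data.Vec.Properties using (length-toList)
import Data.List as List
open import Data.List using ([]; applyUpTo; reverse)
open import Data.List.Properties
  using (applyUpTo-∷ʳ; length-applyUpTo; lookup-applyUpTo; reverse-applyUpTo)
import Data.List.Relation.Unary.All.Properties as All
open import Data.List.Relation.Unary.AllPairs using (AllPairs; _∷_)
open import Data.List.Relation.Unary.Linked using (Linked; [-]; _∷_)
open import Data.List.Relation.Unary.Unique.Propositional using (Unique)
import Data.List.Relation.Unary.Linked.Properties as Linked
import Data.List.Relation.Unary.Unique.Propositional.Properties as Unique
open import Data.Product using (_,_; proj₁; proj₂; ∃-syntax)
open import Data.Sum using (inj₁; inj₂; swap)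
open import Data.Unit using (tt)
open import Data.Empty using (⊥; ⊥-elim)
open import Function using (_∘_; case_of_)
open import Relation.Nullary using (Dec; yes; no; contradiction)
open import Relation.Nullary.Decidable using (_⊎-dec_)
open import Relation.Nullary.Decidable.Core using (T?)
open import Relation.Binary.Construct.Closure.Transitive using (TransClosure; [_]; _∷_; _++_)
open import Relation.Binary.PropositionalEquality

module _ {A : Set} where

  infixr 5 _++[_]_
  _++[_]_ : (ℕ → A) → ℕ → (ℕ → A) → ℕ → A
  (f ++[ zero  ] g) k       = g k
  (f ++[ suc a ] g) zero    = f zero
  (f ++[ suc a ] g) (suc k) = ((f ∘ suc) ++[ a ] g) k

  ++[]-left : ∀ (f g : ℕ → A) {a k} → k < a → (f ++[ a ] g) k ≡ f k
  ++[]-left f g {suc a} {zero}  _         = refl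
  ++[]-left f g {suc a} {suc k} (s<s k<a) = ++[]-left (f ∘ suc) g k<a

  ++[]-right : ∀ (f g : ℕ → A) a k → (f ++[ a ] g) (a + k) ≡ g k
  ++[]-right f g zero    k = refl
  ++[]-right f g (suc a) k = ++[]-right (f ∘ suc) g a k

  allPairs-applyUpTo⁻ : ∀ {R : A → A → Set} f k → AllPairs R (applyUpTo f k) →
    ∀ {i j} → i < j → j < k → R (f i) (f j)
  allPairs-applyUpTo⁻ f (suc k) (Rf₀ ∷ _) {zero}  {suc j} _         (s<s j<k) =
    All.applyUpTo⁻ (f ∘ suc) k Rf₀ j<k
  allPairs-applyUpTo⁻ f (suc k) (_ ∷ Rf₊) {suc i} {suc j} (s<s i<j) (s<s j<k) =
    allPairs-applyUpTo⁻ (f ∘ suc) k Rf₊ i<j j<k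

  linked-applyUpTo⁻ : ∀ {R : A → A → Set} f k → Linked R (applyUpTo f k) →
    ∀ {i} → suc i < k → R (f i) (f (suc i))
  linked-applyUpTo⁻ f (suc zero)    _          {zero}  (s<s ())
  linked-applyUpTo⁻ f (suc (suc k)) (Rf₀ ∷ _)  {zero}  _         = Rf₀
  linked-applyUpTo⁻ f (suc (suc k)) (_ ∷ Rf₊)  {suc i} (s<s i<k) =
    linked-applyUpTo⁻ (f ∘ suc) (suc k) Rf₊ i<k

data Side (a : ℕ) : ℕ → Set where
  left  : ∀ {k} → k < a → Side a k
  right : ∀ k → Side a (a + k)

side : ∀ a k → Side a k
side zero    k       = right k
side (suc a) zero    = left z<s
side (suc a) (suc k) with side a k
... | left k<a = left (s<s k<a)
... | right k′ = right k′

largest : ∀ {P : ℕ → Set} → (∀ k → Dec (P k)) → ∀ {a} h → a ≤ h → P a →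
  ∃[ b ] a ≤ b × b ≤ h × P b × (∀ {k} → b < k → k ≤ h → ¬ P k)
largest P? zero z≤n Pa = 0 , z≤n , z≤n , Pa , λ 0<k k≤0 → contradiction k≤0 (<⇒≱ 0<k)
largest P? (suc h) a≤h+1 Pa with P? (suc h)
... | yes Ph = suc h , a≤h+1 , ≤-refl , Ph , λ h<k k≤h → contradiction k≤h (<⇒≱ h<k)
... | no ¬Ph =
  let a≤h = ≤-pred (≤∧≢⇒< a≤h+1 λ { refl → ¬Ph Pa })
      b , a≤b , b≤h , Pb , beyond = largest P? h a≤h Pa
  in b , a≤b , m≤n⇒m≤1+n b≤h , Pb , λ b<k k≤h+1 → case m≤n⇒m<n∨m≡n k≤h+1 of λ where
       (inj₁ k≤h) → beyond b<k (≤-pred k≤h)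
       (inj₂ refl) → ¬Ph

module _ {A : Set} where

  at : ∀ {k} → A → Vec A k → ℕ → A
  at d []      _       = d
  at d (a ∷ _) zero    = a
  at d (_ ∷ v) (suc i) = at d v i

  applyUpTo-at : ∀ {k} d (v : Vec A k) → applyUpTo (at d v) k ≡ toList v
  applyUpTo-at d []      = refl
  applyUpTo-at d (a ∷ v) = cong (a ∷_) (applyUpTo-at d v)

  at-lookup : ∀ {k} d (v : Vec A k) i → at d v (toℕ i) ≡ lookup v i
  at-lookup d (a ∷ v) F.zero    = refl
  at-lookup d (a ∷ v) (F.suc i) = at-lookup d v i

  at-∷ʳ : ∀ {k} d (v : Vec A k) z → at d (v ∷ʳ z) k ≡ z
  at-∷ʳ d []      z = refl
  at-∷ʳ d (a ∷ v) z = at-∷ʳ d v z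

  at-∷ʳ-last : ∀ {k} d (v : Vec A (suc k)) z → at d (v ∷ʳ z) k ≡ last v
  at-∷ʳ-last d (a ∷ [])    z = refl
  at-∷ʳ-last d (a ∷ b ∷ v) z = at-∷ʳ-last d (b ∷ v) z

  lookup-∷ʳ-inject₁ : ∀ {k} (v : Vec A k) z i → lookup (v ∷ʳ z) (inject₁ i) ≡ lookup v i
  lookup-∷ʳ-inject₁ (a ∷ v) z F.zero    = refl
  lookup-∷ʳ-inject₁ (a ∷ v) z (F.suc i) = lookup-∷ʳ-inject₁ v z i

module Graph {N : ℕ} (E : Digraph N) where

  Converging : Fin N → Fin N → Fin N → Set
  Converging a b c = Arc E a b × Arc E c b

  adj? : ∀ u v → Dec (Adj E u v)
  adj? u v = T? (E u v) ⊎-dec T? (E v u)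

  Path : Fin N → Fin N → Set
  Path = TransClosure (Arc E)

  path⇒linked : ∀ {u v} → Path u v → ∃[ l ] Linked (Arc E) (u ∷ l List.∷ʳ v)
  path⇒linked [ u→v ]   = [] , u→v ∷ [-]
  path⇒linked (u→w ∷ π) = let l , linked = path⇒linked π in _ ∷ l , u→w ∷ linked

  module _ (acyclic : Acyclic E) where

    acyclic⇒irreflexive : ∀ {u} → ¬ Path u u
    acyclic⇒irreflexive π = let l , linked = path⇒linked π in acyclic _ l linked

    acyclic⇒asym : ∀ {u v} → Arc E u v → ¬ Arc E v u
    acyclic⇒asym u→v v→u = acyclic⇒irreflexive (u→v ∷ [ v→u ])

  record IsActiveTrail (p : ℕ → Fin N) (k : ℕ) : Set where
    field
      distinct      : ∀ {i j} → i < j → j < k → p i ≢ p j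
      adjacent      : ∀ {i} → suc i < k → Adj E (p i) (p (suc i))
      nonConverging : ∀ {i} → suc (suc i) < k → ¬ Converging (p i) (p (suc i)) (p (suc (suc i)))

  open IsActiveTrail

  noConverging-applyUpTo⁺ : ∀ p k →
    (∀ {i} → suc (suc i) < k → ¬ Converging (p i) (p (suc i)) (p (suc (suc i)))) →
    NoConverging E (applyUpTo p k)
  noConverging-applyUpTo⁺ p zero                   _ = tt
  noConverging-applyUpTo⁺ p (suc zero)             _ = tt
  noConverging-applyUpTo⁺ p (suc (suc zero))       _ = tt
  noConverging-applyUpTo⁺ p (suc k@(suc (suc _))) nc =
    nc (s<s (s<s z<s)) , noConverging-applyUpTo⁺ (p ∘ suc) k (nc ∘ s<s)

  noConverging-applyUpTo⁻ : ∀ p k → NoConverging E (applyUpTo p k) →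
    ∀ {i} → suc (suc i) < k → ¬ Converging (p i) (p (suc i)) (p (suc (suc i)))
  noConverging-applyUpTo⁻ p (suc zero)          _         {zero}  (s<s ())
  noConverging-applyUpTo⁻ p (suc (suc zero))    _         {_}     (s<s (s<s ()))
  noConverging-applyUpTo⁻ p (suc (suc (suc k))) (nc₀ , _) {zero}  _         = nc₀
  noConverging-applyUpTo⁻ p (suc (suc (suc k))) (_ , nc₊) {suc i} (s<s i<k) =
    noConverging-applyUpTo⁻ (p ∘ suc) (suc (suc k)) nc₊ i<k

  activeTrail-applyUpTo⁺ : ∀ {p k} → IsActiveTrail p k → ActiveTrail E (applyUpTo p k)
  activeTrail-applyUpTo⁺ {p} {k} trail =
    (Unique.applyUpTo⁺₁ p k (distinct trail) , Linked.applyUpTo⁺₁ p k (adjacent trail)) ,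
    noConverging-applyUpTo⁺ p k (nonConverging trail)

  activeTrail-applyUpTo⁻ : ∀ {p k} → ActiveTrail E (applyUpTo p k) → IsActiveTrail p k
  activeTrail-applyUpTo⁻ {p} {k} ((unique , linked) , nc) = record
    { distinct      = allPairs-applyUpTo⁻ p k unique
    ; adjacent      = linked-applyUpTo⁻ p k linked
    ; nonConverging = noConverging-applyUpTo⁻ p k nc
    }

  prefix-active : ∀ {p k l} → l ≤ k → IsActiveTrail p k → IsActiveTrail p l
  prefix-active l≤k trail = record
    { distinct      = λ i<j j<l → distinct trail i<j (<-≤-trans j<l l≤k)
    ; adjacent      = λ i<l → adjacent trail (<-≤-trans i<l l≤k)
    ; nonConverging = λ i<l → nonConverging trail (<-≤-trans i<l l≤k)
    }

  segment-active : ∀ {p k l} j → l + j ≤ k → IsActiveTrail p k → IsActiveTrail (λ i → p (i + j)) l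
  segment-active {k = k} {l} j l+j≤k trail = record
    { distinct      = λ i<i′ i′<l → distinct trail (+-monoˡ-< j i<i′) (shifted i′<l)
    ; adjacent      = λ i<l → adjacent trail (shifted i<l)
    ; nonConverging = λ i<l → nonConverging trail (shifted i<l)
    }
    where
    shifted : ∀ {i} → i < l → i + j < k
    shifted i<l = <-≤-trans (+-monoˡ-< j i<l) l+j≤k

  tail-active : ∀ {p k} → IsActiveTrail p (suc k) → IsActiveTrail (p ∘ suc) k
  tail-active trail = record
    { distinct      = λ i<j j<k → distinct trail (s<s i<j) (s<s j<k)
    ; adjacent      = adjacent trail ∘ s<s
    ; nonConverging = nonConverging trail ∘ s<s
    }

  cons-active : ∀ {φ k} → IsActiveTrail (φ ∘ suc) k →
    (∀ {j} → j < k → φ 0 ≢ φ (suc j)) → (0 < k → Adj E (φ 0) (φ 1)) →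
    (1 < k → ¬ Converging (φ 0) (φ 1) (φ 2)) →
    IsActiveTrail φ (suc k)
  cons-active {φ} {k} trail head-new head-adj head-nc = record
    { distinct = distinct′ ; adjacent = adjacent′ ; nonConverging = nonConverging′ }
    where
    distinct′ : ∀ {i j} → i < j → j < suc k → φ i ≢ φ j
    distinct′ {zero}  {suc j} _         (s<s j<k) = head-new j<k
    distinct′ {suc i} {suc j} (s<s i<j) (s<s j<k) = distinct trail i<j j<k
    adjacent′ : ∀ {i} → suc i < suc k → Adj E (φ i) (φ (suc i))
    adjacent′ {zero}  (s<s 0<k) = head-adj 0<k
    adjacent′ {suc i} (s<s i<k) = adjacent trail i<k
    nonConverging′ : ∀ {i} → suc (suc i) < suc k →
      ¬ Converging (φ i) (φ (suc i)) (φ (suc (suc i)))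
    nonConverging′ {zero}  (s<s 1<k) = head-nc 1<k
    nonConverging′ {suc i} (s<s i<k) = nonConverging trail i<k

  ++[]-active : ∀ {f g a b} → IsActiveTrail f (suc a) → IsActiveTrail g (suc b) →
    (∀ {i j} → i ≤ a → j ≤ b → f i ≢ g j) → Adj E (f a) (g 0) →
    (∀ {a′} → a ≡ suc a′ → ¬ Converging (f a′) (f a) (g 0)) →
    (∀ {b′} → b ≡ suc b′ → ¬ Converging (f a) (g 0) (g 1)) →
    IsActiveTrail (f ++[ suc a ] g) (suc a + suc b)
  ++[]-active {f} {g} {zero} {b} _ trail-g apart bridge _ nc-right =
    cons-active trail-g (apart z≤n ∘ ≤-pred) (λ _ → bridge) nc-head
    where
    nc-head : 1 < suc b → ¬ Converging (f 0) (g 0) (g 1)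
    nc-head (s<s (s<s _)) = nc-right refl
  ++[]-active {f} {g} {suc a} {b} trail-f trail-g apart bridge nc-left nc-right =
    cons-active rest-active head-new (λ _ → adjacent trail-f (s<s z<s))
      (λ _ → nc-head trail-f nc-left)
    where
    rest-active : IsActiveTrail ((f ∘ suc) ++[ suc a ] g) (suc a + suc b)
    rest-active = ++[]-active (tail-active trail-f) trail-g (apart ∘ s≤s) bridge
      (λ { refl → nc-left refl }) nc-right
    head-new : ∀ {j} → j < suc a + suc b → f 0 ≢ ((f ∘ suc) ++[ suc a ] g) j
    head-new {j} j< with side (suc a) j
    ... | left j<a = λ eq →
      distinct trail-f z<s (s<s j<a) (trans eq (++[]-left (f ∘ suc) g j<a))
    ... | right j′ = λ eq →
      apart z≤n (≤-pred (+-cancelˡ-< (suc a) j′ (suc b) j<))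
        (trans eq (++[]-right (f ∘ suc) g (suc a) j′))
    nc-head : ∀ {a} → IsActiveTrail f (suc (suc a)) →
      (∀ {a′} → suc a ≡ suc a′ → ¬ Converging (f a′) (f (suc a)) (g 0)) →
      ¬ Converging (f 0) (f 1) (((f ∘ suc) ++[ suc a ] g) 1)
    nc-head {zero}  _       nc-left = nc-left refl
    nc-head {suc _} trail-f _       = nonConverging trail-f (s<s (s<s z<s))

  record IsInwardTrail (q : ℕ → Fin N) (k : ℕ) : Set where
    field
      active    : IsActiveTrail q (2 + k)
      firstInto : Arc E (q 1) (q 0)
      lastInto  : Arc E (q k) (q (suc k))

  inwardTrail-applyUpTo⁺ : ∀ {q k} → IsInwardTrail q k → let l = applyUpTo q (2 + k) in
    ActiveTrail E l × Between E (q 0) (q (suc k)) l ×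
    FirstArcInto E (q 0) l × LastArcInto E (q (suc k)) l
  inwardTrail-applyUpTo⁺ {q} {k} inward =
    activeTrail-applyUpTo⁺ active , (refl , proj₁ ends) , (refl , firstInto) , proj₂ ends
    where
    open IsInwardTrail inward
    ends : StartsAt E (q (suc k)) (reverse (applyUpTo q (2 + k))) ×
           LastArcInto E (q (suc k)) (applyUpTo q (2 + k))
    ends rewrite reverse-applyUpTo q (2 + k) = refl , refl , lastInto

  IsChordlessCycle : (ℕ → Fin N) → ℕ → Set
  IsChordlessCycle f k =
    ∀ {i j} → i < j → j < k → suc i ≢ j → ¬ (i ≡ 0 × suc j ≡ k) → ¬ Adj E (f i) (f j)

  chordless-applyUpTo⁺ : ∀ {f} k → IsChordlessCycle f k → Chordless E (applyUpTo f k)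
  chordless-applyUpTo⁺ {f} k chordless i j i<j i+1≢j ¬ends
    rewrite lookup-applyUpTo f k i | lookup-applyUpTo f k j =
    chordless i<j (subst (toℕ j <_) (length-applyUpTo f k) (toℕ<n j)) i+1≢j
      (λ (i≡0 , j-last) → ¬ends (i≡0 , trans j-last (sym (length-applyUpTo f k))))

  toActiveCycle : ∀ {v c k} → IsActiveTrail c (3 + k) → Arc E (c 0) v → Arc E (c (2 + k)) v →
    (∀ {j} → j < 3 + k → v ≢ c j) → IsChordlessCycle ((λ _ → v) ++[ 1 ] c) (4 + k) →
    ActiveCycle E
  toActiveCycle {v} {c} {k} trail w→v z→v v∉c chordless =
    v , c 0 , c (2 + k) , c 1 , applyUpTo (λ j → c (2 + j)) k ,
    distinct trail z<s (n<1+n (2 + k)) , w→v , z→v ,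
    subst (λ l → ActiveTrail E l × Unique (v ∷ l) × Chordless E (v ∷ l)) (sym closed)
      (activeTrail-applyUpTo⁺ trail , Unique.applyUpTo⁺₁ _ (4 + k) cycle-distinct ,
       chordless-applyUpTo⁺ (4 + k) chordless)
    where
    closed : c 0 ∷ (c 1 ∷ applyUpTo (λ j → c (2 + j)) k) List.∷ʳ c (2 + k) ≡ applyUpTo c (3 + k)
    closed = cong (c 0 ∷_) (applyUpTo-∷ʳ (c ∘ suc) (suc k))
    cycle-distinct : ∀ {i j} → i < j → j < 4 + k →
      ((λ _ → v) ++[ 1 ] c) i ≢ ((λ _ → v) ++[ 1 ] c) j
    cycle-distinct {zero}  {suc j} _         (s<s j<) = v∉c j<
    cycle-distinct {suc i} {suc j} (s<s i<j) (s<s j<) = distinct trail i<j j<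

  module Orientation (acyclic : Acyclic E) {p : ℕ → Fin N} {k : ℕ} (trail : IsActiveTrail p k) where

    Forward Backward : ℕ → Set
    Forward  i = Arc E (p i) (p (suc i))
    Backward i = Arc E (p (suc i)) (p i)

    forward-suc : ∀ {i} → suc (suc i) < k → Forward i → Forward (suc i)
    forward-suc i<k fwd with adjacent trail i<k
    ... | inj₁ fwd′ = fwd′
    ... | inj₂ bwd  = contradiction (fwd , bwd) (nonConverging trail i<k)

    backward-pred : ∀ {i} → suc (suc i) < k → Backward (suc i) → Backward i
    backward-pred i<k bwd with adjacent trail (<⇒≤ i<k)
    ... | inj₂ bwd′ = bwd′
    ... | inj₁ fwd  = contradiction bwd (acyclic⇒asym acyclic (forward-suc i<k fwd))

    forward-path : ∀ {i j} → i < j → j < k → Forward i → Path (p i) (p j)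
    forward-path {i} (s≤s i≤j) j<k fwd = proj₂ (go (≤⇒≤′ i≤j) j<k)
      where
      go : ∀ {j} → i ≤′ j → suc j < k → Forward j × Path (p i) (p (suc j))
      go ≤′-refl         _   = fwd , [ fwd ]
      go (≤′-step i≤j) j<k =
        let fwd′ , π = go i≤j (<⇒≤ j<k)
            fwd″     = forward-suc j<k fwd′
        in fwd″ , π ++ [ fwd″ ]

    backward-path : ∀ {i j} → j ≤ i → suc i < k → Backward i → Path (p (suc i)) (p j)
    backward-path {j = j} j≤i = go (≤⇒≤′ j≤i)
      where
      go : ∀ {i} → j ≤′ i → suc i < k → Backward i → Path (p (suc i)) (p j)
      go ≤′-refl         _   bwd = [ bwd ]
      go (≤′-step j≤i) i<k bwd = bwd ∷ go j≤i (<⇒≤ i<k) (backward-pred i<k bwd)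

    forward-into-last : ∀ {n} → suc n < k → Arc E (p 0) (p (suc n)) → Forward n
    forward-into-last n<k first→last with adjacent trail n<k
    ... | inj₁ fwd = fwd
    ... | inj₂ bwd =
      contradiction (backward-path z≤n n<k bwd ++ [ first→last ]) (acyclic⇒irreflexive acyclic)

  module ShortestInwardTrail (acyclic : Acyclic E) (noActiveCycle : ¬ ActiveCycle E)
    {p : ℕ → Fin N} {n : ℕ} (trail : IsActiveTrail p (2 + n))
    (v₁→v₂ : Arc E (p 0) (p (suc n))) (x₁→v₁ : Arc E (p 1) (p 0))
    (xₙ→v₂ : Arc E (p n) (p (suc n)))
    (shortest : ∀ {q k} → IsInwardTrail q k → q 0 ≡ p 0 → q (suc k) ≡ p (suc n) → n ≤ k) where

    open Orientation acyclic trail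

    bypass : ℕ → ℕ → ℕ → Fin N
    bypass i j = p ++[ suc i ] (λ l → p (l + j))

    bypass-inward : ∀ {i j r} → suc i < j → r + j ≡ suc n → Adj E (p i) (p j) →
      (∀ {i′} → i ≡ suc i′ → ¬ Converging (p i′) (p i) (p j)) →
      (j < suc n → ¬ Converging (p i) (p j) (p (suc j))) →
      (i ≡ 0 → Arc E (p j) (p 0)) → (j ≡ suc n → Arc E (p i) (p j)) →
      IsInwardTrail (bypass i j) (i + r)
    bypass-inward {i} {j} {r} i<j r+j≡ chord nc-left nc-right into-first into-last = record
      { active    = subst (IsActiveTrail (bypass i j)) (cong suc (+-suc i r))
                      (++[]-active (prefix-active i<end trail) (segment-active j (≤-reflexive (cong suc r+j≡)) trail)
                         apart chord nc-left (nc-right′ r r+j≡))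
      ; firstInto = first-arc i into-first
      ; lastInto  = last-arc r r+j≡
      }
      where
      j≤end : j ≤ suc n
      j≤end = subst (j ≤_) r+j≡ (m≤n+m j r)
      i<end : suc i ≤ 2 + n
      i<end = ≤-trans (<⇒≤ i<j) (m≤n⇒m≤1+n j≤end)
      apart : ∀ {i′ j′} → i′ ≤ i → j′ ≤ r → p i′ ≢ p (j′ + j)
      apart {i′} {j′} i′≤i j′≤r = distinct trail
        (≤-<-trans i′≤i (<-≤-trans (<-trans (n<1+n i) i<j) (m≤n+m j j′)))
        (s≤s (subst (j′ + j ≤_) r+j≡ (+-monoˡ-≤ j j′≤r)))
      nc-right′ : ∀ r → r + j ≡ suc n → ∀ {r′} → r ≡ suc r′ →
        ¬ Converging (p i) (p j) (p (suc j))
      nc-right′ (suc r′) r+j≡ refl = nc-right (subst (j <_) r+j≡ (s≤s (m≤n+m j r′)))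
      first-arc : ∀ i → (i ≡ 0 → Arc E (p j) (p 0)) → Arc E (bypass i j 1) (bypass i j 0)
      first-arc zero    into = into refl
      first-arc (suc _) _    = x₁→v₁
      last-arc : ∀ r → r + j ≡ suc n → Arc E (bypass i j (i + r)) (bypass i j (suc (i + r)))
      last-arc zero j≡ = subst₂ (Arc E)
        (sym (trans (cong (bypass i j) (+-identityʳ i)) (++[]-left p _ (n<1+n i))))
        (sym (++[]-right p _ (suc i) 0))
        (into-last j≡)
      last-arc (suc r′) r+j≡ = subst₂ (Arc E)
        (sym (trans (cong (bypass i j) (+-suc i r′)) (++[]-right p _ (suc i) r′)))
        (sym (++[]-right p _ (suc i) (suc r′)))
        (subst Forward (sym (suc-injective r+j≡)) xₙ→v₂)

    no-bypass : ∀ {i j} → suc i < j → j ≤ suc n → Adj E (p i) (p j) →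
      (∀ {i′} → i ≡ suc i′ → ¬ Converging (p i′) (p i) (p j)) →
      (j < suc n → ¬ Converging (p i) (p j) (p (suc j))) →
      (i ≡ 0 → Arc E (p j) (p 0)) → (j ≡ suc n → Arc E (p i) (p j)) → ⊥
    no-bypass {i} {j} i<j j≤end chord nc-left nc-right into-first into-last =
      <⇒≱ shorter
        (shortest (bypass-inward i<j r+j≡ chord nc-left nc-right into-first into-last) refl end)
      where
      r = suc n ∸ j
      r+j≡ : r + j ≡ suc n
      r+j≡ = m∸n+n≡m j≤end
      end : bypass i j (suc (i + r)) ≡ p (suc n)
      end = trans (++[]-right p _ (suc i) r) (cong p r+j≡)
      shorter : i + r < n
      shorter = ≤-pred (≤-trans (+-monoˡ-≤ r i<j) (≤-reflexive (trans (+-comm j r) r+j≡)))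

    no-chord : ∀ {i j} → 1 ≤ i → suc i < j → j ≤ suc n → ¬ Adj E (p i) (p j)
    no-chord {suc i} {suc j} _ (s≤s i<j) j≤end chord =
      no-bypass (s≤s i<j) j≤end chord nc-left nc-right (λ ()) (into-last chord)
      where
      j<end : suc j < 2 + n
      j<end = s≤s j≤end
      i<end : suc i < 2 + n
      i<end = <-trans (m<n⇒m<1+n i<j) j<end
      nc-left : ∀ {i′} → suc i ≡ suc i′ → ¬ Converging (p i′) (p (suc i)) (p (suc j))
      nc-left refl (fwd , bwd) = acyclic⇒irreflexive acyclic
        (forward-path (m<n⇒m<1+n i<j) j<end
           (forward-suc (≤-<-trans i<j (<-trans (n<1+n j) j<end)) fwd)
         ++ [ bwd ])
      nc-right : suc j < suc n → ¬ Converging (p (suc i)) (p (suc j)) (p (suc (suc j)))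
      nc-right j<n (fwd , bwd) = acyclic⇒irreflexive acyclic
        (fwd ∷ backward-path (<⇒≤ i<j) j<end (backward-pred (s≤s j<n) bwd))
      into-last : Adj E (p (suc i)) (p (suc j)) → suc j ≡ suc n → Arc E (p (suc i)) (p (suc j))
      into-last (inj₁ fwd) _   = fwd
      into-last (inj₂ bwd) j≡n with adjacent trail i<end
      ... | inj₁ fwd  = contradiction (fwd , bwd) (nc-left refl)
      ... | inj₂ bwd′ = contradiction
        (backward-path z≤n i<end bwd′ ++ subst (Arc E (p 0) ∘ p) (sym j≡n) v₁→v₂ ∷ [ bwd ])
        (acyclic⇒irreflexive acyclic)

    Spoke : ℕ → Set
    Spoke t = Converging (p t) (p (suc t)) (p 0)

    spoke-of-chord : ∀ {t} → 1 ≤ t → t < n → Adj E (p 0) (p (suc t)) → Spoke t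
    spoke-of-chord {t} _ t<n (inj₁ out) with adjacent trail (m<n⇒m<1+n (s≤s t<n))
    ... | inj₁ fwd = fwd , out
    ... | inj₂ bwd = contradiction (backward-path z≤n (m<n⇒m<1+n (s≤s t<n)) bwd ++ [ out ])
                       (acyclic⇒irreflexive acyclic)
    spoke-of-chord {t} 1≤t t<n (inj₂ into) =
      ⊥-elim (no-bypass (s≤s 1≤t) (<⇒≤ (s≤s t<n)) (inj₂ into) (λ ())
        (λ _ (out , _) → acyclic⇒asym acyclic out into) (λ _ → into)
        (λ t≡n → contradiction (suc-injective t≡n) (<⇒≢ t<n)))

    hub-neighbour-nonConverging : ∀ {b} → 1 ≤ b → b < n → Adj E (p 0) (p b) →
      ¬ Converging (p 0) (p b) (p (suc b))
    hub-neighbour-nonConverging {1} _ 1<n _ = nonConverging trail (s≤s (s≤s (<⇒≤ 1<n)))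
    hub-neighbour-nonConverging {suc (suc b)} _ b<n chord (_ , bwd) = acyclic⇒asym acyclic
      (forward-suc (s≤s (s≤s (<⇒≤ b<n)))
        (proj₁ (spoke-of-chord (s≤s z≤n) (<-trans (n<1+n (suc b)) b<n) chord)))
      bwd

    hub-cycle : ∀ {b t} → 1 ≤ b → b ≤ t → t < n → Spoke (suc t) → Adj E (p 0) (p b) →
      (∀ {j} → b < j → j ≤ suc t → ¬ Adj E (p 0) (p j)) → ActiveCycle E
    hub-cycle {b} {t} 1≤b b≤t t<n (x→v , hub→v) chord beyond =
      toActiveCycle c-active hub→v (subst (λ m → Arc E (p (suc m)) v) (sym r+b≡t) x→v)
        v-fresh chordless
      where
      v = p (2 + t)
      r = t ∸ b
      r+b≡t : r + b ≡ t
      r+b≡t = m∸n+n≡m b≤t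
      along : ∀ {j} → j ≤ suc r → j + b ≤ suc t
      along {j} j≤ = subst (j + b ≤_) (cong suc r+b≡t) (+-monoˡ-≤ b j≤)
      v-end : 2 + t < 2 + n
      v-end = s≤s (s≤s t<n)
      c : ℕ → Fin N
      c = p ++[ 1 ] (λ j → p (j + b))
      c-active : IsActiveTrail c (3 + r)
      c-active = cons-active
        (segment-active b (s≤s (s≤s (subst (_≤ n) (sym r+b≡t) (<⇒≤ t<n)))) trail)
        (λ j< → distinct trail (<-≤-trans 1≤b (m≤n+m b _))
                  (<-trans (s≤s (along (≤-pred j<))) v-end))
        (λ _ → chord)
        (λ _ → hub-neighbour-nonConverging 1≤b (≤-<-trans b≤t t<n) chord)
      v-fresh : ∀ {j} → j < 3 + r → v ≢ c j
      v-fresh {zero}  _        = ≢-sym (distinct trail z<s v-end)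
      v-fresh {suc j} (s≤s j<) = ≢-sym (distinct trail (s≤s (along (≤-pred j<))) v-end)
      chordless : IsChordlessCycle ((λ _ → v) ++[ 1 ] c) (4 + r)
      chordless {zero}        {suc zero}          _ _ not-next _ = contradiction refl not-next
      chordless {zero}        {suc (suc j)}       _ (s≤s (s≤s j<)) _ not-ends =
        no-chord (≤-trans 1≤b (m≤n+m b j))
          (s≤s (s≤s (subst (j + b ≤_) r+b≡t (+-monoˡ-≤ b j≤r)))) (s≤s t<n)
        ∘ swap
        where
        j≤r : j ≤ r
        j≤r = ≤-pred (≤∧≢⇒< (≤-pred j<) (λ j≡ → not-ends (refl , cong (3 +_) j≡)))
      chordless {suc zero}    {suc zero}          (s≤s ())
      chordless {suc zero}    {suc (suc zero)}    _ _ not-next _ = contradiction refl not-next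
      chordless {suc zero}    {suc (suc (suc j))} _ (s≤s (s≤s j<)) _ _ =
        beyond (s≤s (m≤n+m b j)) (along (≤-pred j<))
      chordless {suc (suc i)} {suc (suc j)} (s≤s (s≤s i<j)) (s≤s (s≤s j<)) not-next _ =
        no-chord (≤-trans 1≤b (m≤n+m b i))
          (+-monoˡ-< b (≤∧≢⇒< i<j (not-next ∘ cong (2 +_))))
          (m≤n⇒m≤1+n (≤-trans (along (≤-pred j<)) t<n))

    spoke-pred : ∀ {t} → 1 ≤ t → t < n → Spoke (suc t) → Spoke t
    spoke-pred {t} 1≤t t<n spoke
      with largest (adj? (p 0) ∘ p) (suc t) (s≤s z≤n) (adjacent trail (s≤s (s≤s z≤n)))
    ... | b , 1≤b , b≤t+1 , chord , beyond with m≤n⇒m<n∨m≡n b≤t+1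
    ...   | inj₁ b≤t  =
      ⊥-elim (noActiveCycle (hub-cycle 1≤b (≤-pred b≤t) t<n spoke chord beyond))
    ...   | inj₂ refl = spoke-of-chord 1≤t t<n chord

    spokes : ∀ {t} → 1 ≤ t → t ≤ n → Spoke t
    spokes 1≤t t≤n = go (≤⇒≤‴ t≤n) 1≤t
      where
      go : ∀ {t} → t ≤‴ n → 1 ≤ t → Spoke t
      go ≤‴-refl         _   = xₙ→v₂ , v₁→v₂
      go (≤‴-step t<n) 1≤t = spoke-pred 1≤t (≤‴⇒≤ t<n) (go t<n (s≤s z≤n))

    fan : (∀ {i} → 1 ≤ i → i ≤ n → Arc E (p i) (p (suc i)))
        × (∀ {j} → 2 ≤ j → j ≤ n → Arc E (p 0) (p j))
    fan = (λ 1≤i i≤n → proj₁ (spokes 1≤i i≤n))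
        , λ { {suc j} (s≤s 1≤j) j≤n → proj₂ (spokes 1≤j (<⇒≤ j≤n)) }

module VectorTrail {N : ℕ} (E : Digraph N) (acyclic : Acyclic E) (noActiveCycle : ¬ ActiveCycle E)
  {v₁ v₂ : Fin N} (v₁→v₂ : Arc E v₁ v₂) {m : ℕ} {x₁ : Fin N} {xs : Vec (Fin N) m}
  (active : ActiveTrail E (v₁ ∷ toList ((x₁ ∷ xs) ∷ʳ v₂))) where

  open Graph E

  x : Vec (Fin N) (suc m)
  x = x₁ ∷ xs

  p : ℕ → Fin N
  p = at v₁ (v₁ ∷ (x ∷ʳ v₂))

  trail : IsActiveTrail p (3 + m)
  trail = activeTrail-applyUpTo⁻
    (subst (ActiveTrail E) (sym (applyUpTo-at v₁ (v₁ ∷ (x ∷ʳ v₂)))) active)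

  p-end : p (2 + m) ≡ v₂
  p-end = at-∷ʳ v₁ x v₂

  p-inject₁ : ∀ i → p (suc (toℕ i)) ≡ lookup (x ∷ʳ v₂) (inject₁ i)
  p-inject₁ i = trans (cong (at v₁ (x ∷ʳ v₂)) (sym (toℕ-inject₁ i)))
                      (at-lookup v₁ (x ∷ʳ v₂) (inject₁ i))

  last→v₂ : Arc E (last x) v₂
  last→v₂ = subst₂ (Arc E) (at-∷ʳ-last v₁ x v₂) p-end
    (Orientation.forward-into-last acyclic trail (n<1+n (2 + m))
      (subst (Arc E v₁) (sym p-end) v₁→v₂))

  fan-lookup : Arc E x₁ v₁ → Arc E (last x) v₂ →
    ((l : List (Fin N)) → ActiveTrail E l → Between E v₁ v₂ l → FirstArcInto E v₁ l →
      LastArcInto E v₂ l → length (v₁ ∷ toList (x ∷ʳ v₂)) ≤ length l) →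
    ((i : Fin (suc m)) → Arc E (lookup (x ∷ʳ v₂) (inject₁ i)) (lookup (x ∷ʳ v₂) (F.suc i)))
    × ((i : Fin (suc m)) → 1 ≤ toℕ i → Arc E v₁ (lookup x i))
  fan-lookup x₁→v₁ xₙ→v₂ minimal =
    (λ i → subst₂ (Arc E) (p-inject₁ i) (at-lookup v₁ (x ∷ʳ v₂) (F.suc i))
             (proj₁ fan (s≤s z≤n) (toℕ<n i))) ,
    (λ i 1≤i → subst (Arc E v₁) (trans (p-inject₁ i) (lookup-∷ʳ-inject₁ x v₂ i))
                 (proj₂ fan (s≤s 1≤i) (toℕ<n i)))
    where
    shortest : ∀ {q k} → IsInwardTrail q k → q 0 ≡ p 0 → q (suc k) ≡ p (2 + m) → suc m ≤ k
    shortest {q} {k} inward q₀ q-end =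
      let active′ , ends = inwardTrail-applyUpTo⁺ inward
          between , first-into , last-into = subst₂
            (λ u w → let l = applyUpTo q (2 + k) in
                     Between E u w l × FirstArcInto E u l × LastArcInto E w l)
            q₀ (trans q-end p-end) ends
      in ≤-pred (≤-pred (subst₂ _≤_
           (cong suc (length-toList (x ∷ʳ v₂))) (length-applyUpTo q (2 + k))
           (minimal _ active′ between first-into last-into)))
    open ShortestInwardTrail acyclic noActiveCycle trail
      (subst (Arc E v₁) (sym p-end) v₁→v₂) x₁→v₁
      (subst₂ (Arc E) (sym (at-∷ʳ-last v₁ x v₂)) (sym p-end) xₙ→v₂) shortest
      using (fan)

theorem4p10 : (N : ℕ) (E : Digraph N) → Acyclic E → ¬ ActiveCycle E →
    (v₁ v₂ : Fin N) → Arc E v₁ v₂ →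
    (m : ℕ) (x : Vec (Fin N) (suc m)) →
    ((ActiveTrail E (v₁ ∷ toList (x ∷ʳ v₂)) →
      Arc E (head x) v₁ →
      ((l : List (Fin N)) → ActiveTrail E l → Between E v₁ v₂ l → FirstArcInto E v₁ l →
        length (v₁ ∷ toList (x ∷ʳ v₂)) ≤ length l) →
      ((i : Fin (suc m)) → Arc E (lookup (x ∷ʳ v₂) (inject₁ i)) (lookup (x ∷ʳ v₂) (F.suc i)))
      × ((i : Fin (suc m)) → 1 ≤ toℕ i → Arc E v₁ (lookup x i)))
    × (ActiveTrail E (v₁ ∷ toList (x ∷ʳ v₂)) →
      Arc E (head x) v₁ → Arc E (last x) v₂ →
      ((l : List (Fin N)) → ActiveTrail E l → Between E v₁ v₂ l → FirstArcInto E v₁ l →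
        LastArcInto E v₂ l → length (v₁ ∷ toList (x ∷ʳ v₂)) ≤ length l) →
      ((i : Fin (suc m)) → Arc E (lookup (x ∷ʳ v₂) (inject₁ i)) (lookup (x ∷ʳ v₂) (F.suc i)))
      × ((i : Fin (suc m)) → 1 ≤ toℕ i → Arc E v₁ (lookup x i))))
theorem4p10 N E acyclic noActiveCycle v₁ v₂ v₁→v₂ m (x₁ ∷ xs) =
  (λ active x₁→v₁ minimal → let open VectorTrail E acyclic noActiveCycle v₁→v₂ active in
     fan-lookup x₁→v₁ last→v₂
       (λ l active′ between first-into _ → minimal l active′ between first-into)) ,
  (λ active → VectorTrail.fan-lookup E acyclic noActiveCycle v₁→v₂ active)
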